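{- Let $\vdash$ be a regular entailment relation for a commutative preordered group $G$, let $A$ be a nonempty finite subset of $G$ and $b_1,\dots,b_m\in G$ ($m\geqslant1$). Then $A\vdash b_1,\dots,b_m$ iff $A-b_1,\dots,A-b_m\vdash 0$.
   Context: A commutative preordered group is an abelian group $G$ with a preorder $\leqslant$ such that $a\leqslant b$ implies $a+c\leqslant b+c$. $A,B,A',B'$ denote nonempty finite subsets of $G$; $a$ stands for $\{a\}$, commas denote unions, $A\pm y=\{a\pm y:a\in A\}$. A regular entailment relation for $G$ is a relation $A\vdash B$ between nonempty finite subsets such that: (R1) $A\vdash B$ if $A\supseteq A'$, $B\supseteq B'$ and $A'\vdash B'$; (R2) $A\vdash B$ if $A,y\vdash B$ and $A\vdash B,y$; (R3) $a\vdash b$ if $a\leqslant b$; (R4) $A\vdash B$ if $A+y\vdash B+y$; (R5) $a+u,b+v\vdash a+b,u+v$ for all $a,b,u,v\in G$. -}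

module Defs where

open import Level using (Level; _⊔_) renaming (suc to lsuc)
open import Algebra.Bundles using (AbelianGroup)
open import Relation.Binary.Core using (Rel)
open import Relation.Binary.Structures using (IsPreorder)
open import Data.List.NonEmpty using (List⁺; toList; [_]; _∷_; _⁺++⁺_; map; concatMap)
open import Data.List using ([]; _∷_)
import Data.List.Membership.Setoid as SetoidMembership

-- A commutative preordered group: an abelian group (written multiplicatively
-- in the stdlib: _∙_, ε, _⁻¹, equality _≈_) with a preorder compatible with
-- the group operation.
record PreorderedAbelianGroup (c ℓ₁ ℓ₂ : Level) : Set (lsuc (c ⊔ ℓ₁ ⊔ ℓ₂)) where
  field
    abelianGroup : AbelianGroup c ℓ₁
  open AbelianGroup abelianGroup public
  field
    _≤_        : Rel Carrier ℓ₂
    isPreorder : IsPreorder _≈_ _≤_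
    ∙-monoʳ-≤  : ∀ {a b} c → a ≤ b → (a ∙ c) ≤ (b ∙ c)

module _ {c ℓ₁ ℓ₂ : Level} (G : PreorderedAbelianGroup c ℓ₁ ℓ₂) where
  open PreorderedAbelianGroup G
  open SetoidMembership setoid using (_∈_)

  -- Nonempty finite subsets of G are represented by nonempty lists
  -- (membership taken up to the group's equality _≈_).
  Fin⁺ : Set c
  Fin⁺ = List⁺ Carrier

  _⊇_ : Fin⁺ → Fin⁺ → Set (c ⊔ ℓ₁)
  A ⊇ A' = ∀ {x} → x ∈ toList A' → x ∈ toList A

  _+ₛ_ : Fin⁺ → Carrier → Fin⁺
  A +ₛ y = map (λ a → a ∙ y) A

  _-ₛ_ : Fin⁺ → Carrier → Fin⁺
  A -ₛ y = map (λ a → a ∙ (y ⁻¹)) A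

  _-ₛₛ_ : Fin⁺ → Fin⁺ → Fin⁺
  A -ₛₛ B = concatMap (λ b → A -ₛ b) B

  record IsRegularEntailment {ℓ : Level} (_⊢_ : Fin⁺ → Fin⁺ → Set ℓ)
      : Set (c ⊔ ℓ₁ ⊔ ℓ₂ ⊔ ℓ) where
    field
      R1 : ∀ {A B A′ B′} → A ⊇ A′ → B ⊇ B′ → A′ ⊢ B′ → A ⊢ B
      R2 : ∀ {A B} y → (A ⁺++⁺ [ y ]) ⊢ B → A ⊢ (B ⁺++⁺ [ y ]) → A ⊢ B
      R3 : ∀ {a b} → a ≤ b → [ a ] ⊢ [ b ]
      R4 : ∀ {A B} y → (A +ₛ y) ⊢ (B +ₛ y) → A ⊢ B
      R5 : ∀ a b u v → ((a ∙ u) ∷ (b ∙ v) ∷ []) ⊢ ((a ∙ b) ∷ (u ∙ v) ∷ [])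

-- Read in a lattice-ordered group, A ⊢ B says ⋀A ≤ ⋁B, and both sides of the
-- equivalence say ⋀A − ⋁B ≤ 0; the work is to move the join ⋁B across ⊢ with
-- cuts. Translating by the elements d of B turns A ⊢ B into the family
-- A − B ⊢ B − d, and A − B ⊢ 0 into the family (A + d) − B ⊢ B. Each family is
-- collapsed by induction on B: in the member for the first element b, the
-- element b − b = 0 (resp. the copy (A + b) − b of A) is already in place, and
-- the remaining elements of B − b (resp. (A + b) − B) are cut away one at a
-- time. Each cut is justified by the induction hypothesis together with R5,
-- used as an exchange rule: s, t ⊢ p, q whenever s + t = p + q.

module Submission where

open import Defs
open import Level using (Level)
open import Data.List using ([]; _∷_; _++_)
open import Data.List.NonEmpty using ([_]; _∷_; _∷⁺_; _⁺++_; toList)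
open import Data.List.NonEmpty.Properties using (toList->>=)
open import Data.List.Relation.Unary.Any as Any using (here; there)
open import Data.Product using (∃; ∃₂; _×_; _,_)
open import Data.Sum using ([_,_]′)
open import Function.Base using (id; _∘_)
open import Function.Bundles using (_⇔_; mk⇔)
import Relation.Binary.PropositionalEquality as ≡
import Algebra.Properties.AbelianGroup as AbelianGroupProperties
import Algebra.Properties.CommutativeSemigroup as CommutativeSemigroupProperties
import Algebra.Solver.CommutativeMonoid as CommutativeMonoidSolver
import Data.List.Membership.Setoid as SetoidMembership
import Data.List.Membership.Setoid.Properties as SetoidMembershipProperties
import Data.List.Relation.Binary.Subset.Setoid as SetoidSubset
import Data.List.Relation.Binary.Subset.Setoid.Properties as SetoidSubsetProperties
import Data.List.Relation.Binary.Permutation.Setoid.Properties as SetoidPermutationProperties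

module _ {c ℓ₁ ℓ₂} (G : PreorderedAbelianGroup c ℓ₁ ℓ₂) where
  open PreorderedAbelianGroup G
  open AbelianGroupProperties abelianGroup
    using (//-rightDividesˡ; //-rightDividesʳ; \\-leftDividesˡ; \\-leftDividesʳ)
  open CommutativeSemigroupProperties commutativeSemigroup using (x∙yz≈y∙xz; xy∙z≈xz∙y)
  open CommutativeMonoidSolver commutativeMonoid using (solve; _⊜_; _⊕_)
  open SetoidMembership setoid using (_∈_; find)
  open SetoidMembershipProperties
    using (∈-resp-≈; ∈-map⁺; ∈-map⁻; ∈-concatMap⁺; ∈-concatMap⁻; ∈-++⁻)
  open SetoidSubset setoid using (_⊆_)
  open import Relation.Binary.Reasoning.Setoid setoid

  x∙y⁻¹∙[y∙z]≈x∙z : ∀ x y z → (x ∙ y ⁻¹) ∙ (y ∙ z) ≈ x ∙ z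
  x∙y⁻¹∙[y∙z]≈x∙z x y z = begin
    (x ∙ y ⁻¹) ∙ (y ∙ z)  ≈⟨ assoc (x ∙ y ⁻¹) y z ⟨
    ((x ∙ y ⁻¹) ∙ y) ∙ z  ≈⟨ ∙-congʳ (//-rightDividesˡ y x) ⟩
    x ∙ z                 ∎

  x∙yzu≈ywu∙xzw⁻¹ : ∀ x y z u w → x ∙ ((y ∙ z) ∙ u) ≈ ((y ∙ w) ∙ u) ∙ ((x ∙ z) ∙ w ⁻¹)
  x∙yzu≈ywu∙xzw⁻¹ x y z u w = begin
    x ∙ ((y ∙ z) ∙ u)                 ≈⟨ //-rightDividesʳ w _ ⟨
    ((x ∙ ((y ∙ z) ∙ u)) ∙ w) ∙ w ⁻¹  ≈⟨ solve 6 (λ x y z u w w⁻¹ →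
                                              ((x ⊕ ((y ⊕ z) ⊕ u)) ⊕ w) ⊕ w⁻¹
                                            ⊜ ((y ⊕ w) ⊕ u) ⊕ ((x ⊕ z) ⊕ w⁻¹))
                                          refl x y z u w (w ⁻¹) ⟩
    ((y ∙ w) ∙ u) ∙ ((x ∙ z) ∙ w ⁻¹)  ∎

  xs++[]⊆xs : ∀ xs → xs ++ [] ⊆ xs
  xs++[]⊆xs xs = [ id , (λ ()) ]′ ∘ ∈-++⁻ setoid xs

  ∈-+ₛ⁺ : ∀ {X x} y → x ∈ toList X → x ∙ y ∈ toList (_+ₛ_ G X y)
  ∈-+ₛ⁺ y = ∈-map⁺ setoid setoid ∙-congʳ

  ∈-+ₛ⁻ : ∀ {X y x} → x ∈ toList (_+ₛ_ G X y) → ∃ λ x′ → x′ ∈ toList X × x ≈ x′ ∙ y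
  ∈-+ₛ⁻ = ∈-map⁻ setoid setoid

  ∈-−ₛₛ⁺ : ∀ {A B a b} → a ∈ toList A → b ∈ toList B → a ∙ b ⁻¹ ∈ toList (_-ₛₛ_ G A B)
  ∈-−ₛₛ⁺ {A} {B} {a} {b} a∈A b∈B = ≡.subst (a ∙ b ⁻¹ ∈_) (toList->>= (_-ₛ_ G A) B)
    (∈-concatMap⁺ setoid setoid (Any.map shift b∈B))
    where
    shift : ∀ {d} → b ≈ d → a ∙ b ⁻¹ ∈ toList (_-ₛ_ G A d)
    shift b≈d = ∈-resp-≈ setoid (∙-congˡ (⁻¹-cong (sym b≈d))) (∈-+ₛ⁺ _ a∈A)

  ∈-−ₛₛ⁻ : ∀ {A B x} → x ∈ toList (_-ₛₛ_ G A B) →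
           ∃₂ λ a b → a ∈ toList A × b ∈ toList B × x ≈ a ∙ b ⁻¹
  ∈-−ₛₛ⁻ {A} {B} {x} x∈ =
    let b , b∈B , x∈A-b = find (∈-concatMap⁻ setoid setoid {f = toList ∘ _-ₛ_ G A}
                                 (≡.subst (x ∈_) (≡.sym (toList->>= (_-ₛ_ G A) B)) x∈))
        a , a∈A , x≈a-b = ∈-+ₛ⁻ {A} x∈A-b
    in a , b , a∈A , b∈B , x≈a-b

  ⊆-+ₛ-−ₛ : ∀ {X} y → toList X ⊆ toList (_-ₛ_ G (_+ₛ_ G X y) y)
  ⊆-+ₛ-−ₛ y {x} x∈X = ∈-resp-≈ setoid (//-rightDividesʳ y x) (∈-+ₛ⁺ (y ⁻¹) (∈-+ₛ⁺ y x∈X))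

  +ₛ-−ₛ-⊆ : ∀ {X} y → toList (_-ₛ_ G (_+ₛ_ G X y) y) ⊆ toList X
  +ₛ-−ₛ-⊆ {X} y x∈ =
    let x′ , x′∈ , x≈x′-y = ∈-+ₛ⁻ {_+ₛ_ G X y} x∈
        x″ , x″∈X , x′≈x″+y = ∈-+ₛ⁻ {X} x′∈
    in ∈-resp-≈ setoid (sym (trans x≈x′-y (trans (∙-congʳ x′≈x″+y) (//-rightDividesʳ y x″))))
         x″∈X

  −ₛ⊆−ₛₛ : ∀ {A B b} → b ∈ toList B → toList (_-ₛ_ G A b) ⊆ toList (_-ₛₛ_ G A B)
  −ₛ⊆−ₛₛ {A} {B} b∈B x∈ =
    let a , a∈A , x≈a-b = ∈-+ₛ⁻ {A} x∈
    in ∈-resp-≈ setoid (sym x≈a-b) (∈-−ₛₛ⁺ {A} {B} a∈A b∈B)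

  −ₛₛ-+ₛ⊆+ₛ-−ₛₛ : ∀ {A B} y →
                  toList (_+ₛ_ G (_-ₛₛ_ G A B) y) ⊆ toList (_-ₛₛ_ G (_+ₛ_ G A y) B)
  −ₛₛ-+ₛ⊆+ₛ-−ₛₛ {A} {B} y x∈ =
    let x′ , x′∈ , x≈x′+y = ∈-+ₛ⁻ {_-ₛₛ_ G A B} x∈
        a , b , a∈A , b∈B , x′≈a-b = ∈-−ₛₛ⁻ {A} {B} x′∈
    in ∈-resp-≈ setoid (sym (trans x≈x′+y (trans (∙-congʳ x′≈a-b) (xy∙z≈xz∙y a (b ⁻¹) y))))
         (∈-−ₛₛ⁺ {_+ₛ_ G A y} {B} (∈-+ₛ⁺ y a∈A) b∈B)

  module _ {ℓ} {_⊢_ : Fin⁺ G → Fin⁺ G → Set ℓ} (reg : IsRegularEntailment G _⊢_) where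
    open IsRegularEntailment reg
    open SetoidMembershipProperties using (∈-++⁺ˡ; ∈-++-comm)
    open SetoidSubsetProperties using (xs⊆x∷xs; ∈-∷⁺ʳ; ++⁺ˡ; ⊆-reflexive-↭)
    open SetoidPermutationProperties setoid using (↭-shift)

    cut : ∀ {A B} y → (y ∷⁺ A) ⊢ B → A ⊢ (y ∷⁺ B) → A ⊢ B
    cut {A} {B} y y,A⊢B A⊢y,B =
      R2 y (R1 (∈-++-comm setoid (y ∷ []) (toList A)) id y,A⊢B)
           (R1 id (∈-++-comm setoid (y ∷ []) (toList B)) A⊢y,B)

    multicutʳ : ∀ {A B} zs → A ⊢ (B ⁺++ zs) → (∀ {z} → z ∈ zs → (z ∷⁺ A) ⊢ B) → A ⊢ B
    multicutʳ {A} {B} [] A⊢B _ = R1 id (xs++[]⊆xs (toList B)) A⊢B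
    multicutʳ {A} {B} (z ∷ zs) A⊢B,z,zs z,A⊢B =
      multicutʳ zs (cut z (R1 id (λ p → ∈-++⁺ˡ setoid p) (z,A⊢B (here refl)))
                          (R1 id (⊆-reflexive-↭ setoid (↭-shift (toList B) zs)) A⊢B,z,zs))
                   (z,A⊢B ∘ there)

    multicutˡ : ∀ {A B} zs → (A ⁺++ zs) ⊢ B → (∀ {z} → z ∈ zs → A ⊢ (z ∷⁺ B)) → A ⊢ B
    multicutˡ {A} {B} [] A⊢B _ = R1 (xs++[]⊆xs (toList A)) id A⊢B
    multicutˡ {A} {B} (z ∷ zs) A,z,zs⊢B A⊢z,B =
      multicutˡ zs (cut z (R1 (⊆-reflexive-↭ setoid (↭-shift (toList A) zs)) id A,z,zs⊢B)
                          (R1 (λ p → ∈-++⁺ˡ setoid p) id (A⊢z,B (here refl))))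
                   (A⊢z,B ∘ there)

    exchange : ∀ {A B s t p q} → s ∙ t ≈ p ∙ q →
               s ∈ toList A → t ∈ toList A → p ∈ toList B → q ∈ toList B → A ⊢ B
    exchange {s = s} {t} {p} {q} st≈pq s∈A t∈A p∈B q∈B =
      R1 (∈-∷⁺ʳ setoid (back (identityˡ s) s∈A)
           (∈-∷⁺ʳ setoid (back (\\-leftDividesˡ p t) t∈A) (λ ())))
         (∈-∷⁺ʳ setoid (back (identityˡ p) p∈B)
           (∈-∷⁺ʳ setoid (back s∙[p⁻¹∙t]≈q q∈B) (λ ())))
         (R5 ε p s (p ⁻¹ ∙ t))
      where
      back : ∀ {x y xs} → x ≈ y → y ∈ xs → x ∈ xs
      back x≈y = ∈-resp-≈ setoid (sym x≈y)
      s∙[p⁻¹∙t]≈q : s ∙ (p ⁻¹ ∙ t) ≈ q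
      s∙[p⁻¹∙t]≈q = begin
        s ∙ (p ⁻¹ ∙ t)  ≈⟨ x∙yz≈y∙xz s (p ⁻¹) t ⟩
        p ⁻¹ ∙ (s ∙ t)  ≈⟨ ∙-congˡ st≈pq ⟩
        p ⁻¹ ∙ (p ∙ q)  ≈⟨ \\-leftDividesʳ p q ⟩
        q               ∎

    translate : ∀ {A B} y → A ⊢ B → (_+ₛ_ G A y) ⊢ (_+ₛ_ G B y)
    translate y A⊢B = R4 (y ⁻¹) (R1 (⊆-+ₛ-−ₛ y) (⊆-+ₛ-−ₛ y) A⊢B)

    −ₛ-telescope : ∀ {Γ b d z} R → d ∈ toList R → z ∈ toList (_-ₛ_ G R b) →
                   (b ∙ d ⁻¹ ∷⁺ z ∷⁺ Γ) ⊢ _-ₛ_ G R d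
    −ₛ-telescope {b = b} {d} R d∈R z∈R-b =
      let c , c∈R , z≈c-b = ∈-+ₛ⁻ {R} z∈R-b
      in exchange (trans (x∙y⁻¹∙[y∙z]≈x∙z c b (d ⁻¹)) (sym (identityˡ _)))
           (there (here (sym z≈c-b))) (here refl)
           (∈-resp-≈ setoid (inverseʳ d) (∈-+ₛ⁺ {R} (d ⁻¹) d∈R)) (∈-+ₛ⁺ {R} (d ⁻¹) c∈R)

    ⊢ε-if-⊢-shifts : ∀ {Γ} b bs → (∀ {d} → d ∈ b ∷ bs → Γ ⊢ _-ₛ_ G (b ∷ bs) d) → Γ ⊢ [ ε ]
    ⊢ε-if-⊢-shifts b [] Γ⊢B-d =
      R1 id (∈-∷⁺ʳ setoid (here (inverseʳ b)) (λ ())) (Γ⊢B-d (here refl))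
    ⊢ε-if-⊢-shifts b (c ∷ cs) Γ⊢B-d =
      multicutʳ (toList (_-ₛ_ G (c ∷ cs) b))
        (R1 id (∈-∷⁺ʳ setoid (here (inverseʳ b)) (xs⊆x∷xs setoid _ ε)) (Γ⊢B-d (here refl)))
        λ {z} z∈R-b → ⊢ε-if-⊢-shifts c cs λ {d} d∈R →
          cut (b ∙ d ⁻¹) (−ₛ-telescope (c ∷ cs) d∈R z∈R-b)
                         (R1 (xs⊆x∷xs setoid _ z) id (Γ⊢B-d (there d∈R)))

    -- z = (a + b) − e and w = (a′ + d) − b add up to a′ + ((a + d) − e), where a′ = (a′ + d) − d.
    +ₛ-−ₛₛ-swap : ∀ {A Δ b d z w} R → d ∈ toList R →
                  z ∈ toList (_-ₛₛ_ G (_+ₛ_ G A b) R) → w ∈ toList (_-ₛ_ G (_+ₛ_ G A d) b) →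
                  _-ₛₛ_ G (_+ₛ_ G A d) R ⊢ (w ∷⁺ z ∷⁺ Δ)
    +ₛ-−ₛₛ-swap {A} {b = b} {d} R d∈R z∈ w∈ =
      let y , e , y∈ , e∈R , z≈y-e = ∈-−ₛₛ⁻ {_+ₛ_ G A b} {R} z∈
          a , a∈A , y≈a+b = ∈-+ₛ⁻ {A} y∈
          y′ , y′∈ , w≈y′-b = ∈-+ₛ⁻ {_+ₛ_ G A d} w∈
          a′ , a′∈A , y′≈a′+d = ∈-+ₛ⁻ {A} y′∈
      in exchange (x∙yzu≈ywu∙xzw⁻¹ a′ a d (e ⁻¹) b)
           (∈-resp-≈ setoid (//-rightDividesʳ d a′) (∈-−ₛₛ⁺ {B = R} (∈-+ₛ⁺ d a′∈A) d∈R))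
           (∈-−ₛₛ⁺ {B = R} (∈-+ₛ⁺ d a∈A) e∈R)
           (there (here (sym (trans z≈y-e (∙-congʳ y≈a+b)))))
           (here (sym (trans w≈y′-b (∙-congʳ y′≈a′+d))))

    ⊢-if-shifts-⊢ : ∀ {A Δ} b bs →
                    (∀ {d} → d ∈ b ∷ bs → _-ₛₛ_ G (_+ₛ_ G A d) (b ∷ bs) ⊢ Δ) → A ⊢ Δ
    ⊢-if-shifts-⊢ {A} b [] A+d-B⊢Δ =
      R1 (+ₛ-−ₛ-⊆ {A} b ∘ xs++[]⊆xs (toList (_-ₛ_ G (_+ₛ_ G A b) b))) id
         (A+d-B⊢Δ (here refl))
    ⊢-if-shifts-⊢ {A} b (c ∷ cs) A+d-B⊢Δ =
      multicutˡ (toList (_-ₛₛ_ G (_+ₛ_ G A b) (c ∷ cs)))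
        (R1 (++⁺ˡ setoid _ (+ₛ-−ₛ-⊆ {A} b)) id (A+d-B⊢Δ (here refl)))
        λ {z} z∈ → ⊢-if-shifts-⊢ c cs λ {d} d∈R →
          multicutˡ (toList (_-ₛ_ G (_+ₛ_ G A d) b))
            (R1 (∈-++-comm setoid (toList (_-ₛ_ G (_+ₛ_ G A d) b)) _) (xs⊆x∷xs setoid _ z)
                (A+d-B⊢Δ (there d∈R)))
            (+ₛ-−ₛₛ-swap (c ∷ cs) d∈R z∈)

    ⊢⇒−ₛₛ⊢ε : ∀ {A B} → A ⊢ B → _-ₛₛ_ G A B ⊢ [ ε ]
    ⊢⇒−ₛₛ⊢ε {A} {b ∷ bs} A⊢B =
      ⊢ε-if-⊢-shifts b bs (λ {d} d∈B → R1 (−ₛ⊆−ₛₛ d∈B) id (translate (d ⁻¹) A⊢B))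

    −ₛₛ⊢ε⇒⊢ : ∀ {A B} → _-ₛₛ_ G A B ⊢ [ ε ] → A ⊢ B
    −ₛₛ⊢ε⇒⊢ {A} {b ∷ bs} A-B⊢ε =
      ⊢-if-shifts-⊢ b bs (λ {d} d∈B →
        R1 (−ₛₛ-+ₛ⊆+ₛ-−ₛₛ {A} {b ∷ bs} d)
           (∈-∷⁺ʳ setoid (∈-resp-≈ setoid (sym (identityˡ d)) d∈B) (λ ()))
           (translate d A-B⊢ε))

proposition1p8 : ∀ {c ℓ₁ ℓ₂ ℓ : Level} (G : PreorderedAbelianGroup c ℓ₁ ℓ₂)
    (_⊢_ : Fin⁺ G → Fin⁺ G → Set ℓ) → IsRegularEntailment G _⊢_ →
    (A : Fin⁺ G) (bs : Fin⁺ G) →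
    (A ⊢ bs) ⇔ (_-ₛₛ_ G A bs ⊢ [ PreorderedAbelianGroup.ε G ])
proposition1p8 G _⊢_ reg A bs = mk⇔ (⊢⇒−ₛₛ⊢ε G reg) (−ₛₛ⊢ε⇒⊢ G reg)
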